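{- In $\mathsf{CnCK}$: the connectives $\mathbin{\Box\!\!\to}$ and $\mathbin{\Diamond\!\!\to}$ are weakly partially hyperconnexive but neither weakly nor plainly connexive; the connectives $\mathbin{\Box\!\!\Rightarrow}$ and $\mathbin{\Diamond\!\!\Rightarrow}$ are weakly partially connexive but neither weakly nor plainly connexive, nor weakly partially hyperconnexive.
   Context: Conditional formulas are built from propositional letters with $\wedge,\vee,\to$, $\sim$ (strong negation), binary $\mathbin{\Box\!\!\to}$, $\mathbin{\Diamond\!\!\to}$. Defined: $\phi\mathbin{\Box\!\!\Rightarrow}\psi:=(\phi\mathbin{\Box\!\!\to}\psi)\wedge(\sim\psi\mathbin{\Box\!\!\to}\sim\phi)$; $\phi\mathbin{\Diamond\!\!\Rightarrow}\psi:=(\phi\mathbin{\Diamond\!\!\to}\psi)\wedge(\sim\psi\mathbin{\Diamond\!\!\to}\sim\phi)$. A conditional Fischer-Servi model is $(W,\leq,R,V^+,V^-)$, $W\neq\emptyset$, $\leq$ a preorder, $R\subseteq W\times(\mathcal{P}(W))^2\times W$, $V^\pm$ maps letters to $\leq$-upward closed sets, such that for all $X,Y$, $R_{(X,Y)}=\{(w,v)\mid R(w,(X,Y),v)\}$ satisfies (c1) $w\leq w'$, $wR_{(X,Y)}v$ imply $w'R_{(X,Y)}v'$, $v\leq v'$ for some $v'$; (c2) $wR_{(X,Y)}v$, $v\leq v'$ imply $w\leq w'$, $w'R_{(X,Y)}v'$ for some $w'$. Satisfaction: $w\models^\pm p$ iff $w\in V^\pm(p)$; $\wedge$: $+$ iff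 both $+$, $-$ iff some $-$; $\vee$: $+$ iff some $+$, $-$ iff both $-$; $w\models^\pm\sim\psi$ iff $w\models^\mp\psi$; $w\models^+\psi\to\chi$ iff $\forall v\geq w(v\models^+\psi\Rightarrow v\models^+\chi)$; $w\models^-\psi\to\chi$ iff $\forall v\geq w(v\models^+\psi\Rightarrow v\models^-\chi)$; with $\|\psi\|=(\{w\mid w\models^+\psi\},\{w\mid w\models^-\psi\})$: $w\models^\pm\psi\mathbin{\Box\!\!\to}\chi$ iff $\forall v\geq w\,\forall u(vR_{\|\psi\|}u\Rightarrow u\models^\pm\chi)$; $w\models^\pm\psi\mathbin{\Diamond\!\!\to}\chi$ iff $\exists u(wR_{\|\psi\|}u$ and $u\models^\pm\chi)$. $\Gamma\models_{\mathsf{CnCK}}\Delta$ iff no world verifies ($\models^+$) all of $\Gamma$ and none of $\Delta$; $\phi\in\mathsf{CnCK}$ iff $\emptyset\models\{\phi\}$. For a logic $\mathsf{L}$ and binary $\ast$, schemes: (AT) $\sim(\sim\phi\ast\phi)$; (BT) $(\phi\ast\sim\psi)\ast\sim(\phi\ast\psi)$; (nonSym) $(\phi\ast\psi)\ast(\psi\ast\phi)$; (WBT) $\phi\ast\sim\psi\models_\mathsf{L}\sim(\phi\ast\psi)$; (WnonSym) $\phi\ast\psi\models_\mathsf{L}\psi\ast\phi$; (WCBT) $\sim(\phi\ast\psi)\models_\mathsf{L}\phi\ast\sim\psi$. $\ast$ is plainly connexive iff all AT and BT instances are valid and some nonSym instance is not; weakly connexive iff all AT and WBT instances hold and some WnonSym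 instance fails; weakly partially connexive iff all WBT instances hold and some WnonSym instance fails; weakly partially hyperconnexive iff weakly partially connexive and all WCBT instances hold. -}

module Defs where

open import Data.Nat using (ℕ)
open import Data.Product using (Σ; _×_; _,_; ∃)
open import Data.Sum using (_⊎_)
open import Data.List using (List; []; _∷_)
open import Data.List.Relation.Unary.All using (All)
open import Relation.Nullary using (¬_)

infixr 6 _∧_
infixr 5 _∨_
infixr 4 _⇒_ _□→_ _◇→_

data Form : Set where
  var   : ℕ → Form
  _∧_   : Form → Form → Form
  _∨_   : Form → Form → Form
  _⇒_   : Form → Form → Form      -- intuitionistic implication →
  ∼_    : Form → Form
  _□→_  : Form → Form → Form
  _◇→_  : Form → Form → Form

_□⇒_ : Form → Form → Form
φ □⇒ ψ = (φ □→ ψ) ∧ ((∼ ψ) □→ (∼ φ))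

_◇⇒_ : Form → Form → Form
φ ◇⇒ ψ = (φ ◇→ ψ) ∧ ((∼ ψ) ◇→ (∼ φ))

-- Conditional Fischer-Servi models.
-- Subsets of W are predicates W → Set; since P(W) consists of sets,
-- R is required to depend only on the extension of its set arguments
-- (field R-ext).

_≐_ : {W : Set} → (W → Set) → (W → Set) → Set
X ≐ X' = ∀ x → (X x → X' x) × (X' x → X x)

record Model : Set₁ where
  field
    W      : Set
    w₀     : W                         -- W ≠ ∅
    _≤_    : W → W → Set
    ≤-refl : ∀ {w} → w ≤ w
    ≤-trans : ∀ {u v w} → u ≤ v → v ≤ w → u ≤ w
    R      : W → (W → Set) → (W → Set) → W → Set   -- R(w,(X,Y),v)
    R-ext  : ∀ {X X' Y Y' w v} → X ≐ X' → Y ≐ Y' → R w X Y v → R w X' Y' v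
    V⁺     : ℕ → W → Set
    V⁻     : ℕ → W → Set
    V⁺-up  : ∀ p {w v} → w ≤ v → V⁺ p w → V⁺ p v
    V⁻-up  : ∀ p {w v} → w ≤ v → V⁻ p w → V⁻ p v
    c1     : ∀ X Y {w w' v} → w ≤ w' → R w X Y v → Σ W (λ v' → R w' X Y v' × v ≤ v')
    c2     : ∀ X Y {w v v'} → R w X Y v → v ≤ v' → Σ W (λ w' → w ≤ w' × R w' X Y v')

open Model public

data Pol : Set where
  pos neg : Pol

flip : Pol → Pol
flip pos = neg
flip neg = pos

-- sat M pos w φ  is  w ⊨⁺ φ ;  sat M neg w φ  is  w ⊨⁻ φ
sat : (M : Model) → Pol → W M → Form → Set
sat M pos w (var p) = V⁺ M p w
sat M neg w (var p) = V⁻ M p w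
sat M pos w (φ ∧ ψ) = sat M pos w φ × sat M pos w ψ
sat M neg w (φ ∧ ψ) = sat M neg w φ ⊎ sat M neg w ψ
sat M pos w (φ ∨ ψ) = sat M pos w φ ⊎ sat M pos w ψ
sat M neg w (φ ∨ ψ) = sat M neg w φ × sat M neg w ψ
sat M s   w (∼ φ)   = sat M (flip s) w φ
sat M pos w (φ ⇒ ψ) = ∀ v → _≤_ M w v → sat M pos v φ → sat M pos v ψ
sat M neg w (φ ⇒ ψ) = ∀ v → _≤_ M w v → sat M pos v φ → sat M neg v ψ
sat M s   w (φ □→ ψ) =
  ∀ v → _≤_ M w v → ∀ u →
    R M v (λ x → sat M pos x φ) (λ x → sat M neg x φ) u → sat M s u ψ
sat M s   w (φ ◇→ ψ) =
  Σ (W M) (λ u → R M w (λ x → sat M pos x φ) (λ x → sat M neg x φ) u × sat M s u ψ)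

_⊨_ : List Form → List Form → Set₁
Γ ⊨ Δ = ∀ (M : Model) (w : W M) →
  ¬ (All (λ γ → sat M pos w γ) Γ × All (λ δ → ¬ sat M pos w δ) Δ)

Valid : Form → Set₁
Valid φ = [] ⊨ (φ ∷ [])

_⊨₁_ : Form → Form → Set₁
φ ⊨₁ ψ = (φ ∷ []) ⊨ (ψ ∷ [])

BinOp : Set
BinOp = Form → Form → Form

AT : BinOp → Set₁
AT _*_ = ∀ φ → Valid (∼ ((∼ φ) * φ))

BT : BinOp → Set₁
BT _*_ = ∀ φ ψ → Valid ((φ * (∼ ψ)) * (∼ (φ * ψ)))

WBT : BinOp → Set₁
WBT _*_ = ∀ φ ψ → (φ * (∼ ψ)) ⊨₁ (∼ (φ * ψ))

WCBT : BinOp → Set₁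
WCBT _*_ = ∀ φ ψ → (∼ (φ * ψ)) ⊨₁ (φ * (∼ ψ))

SomeNonSymFails : BinOp → Set₁
SomeNonSymFails _*_ = Σ Form (λ φ → Σ Form (λ ψ → ¬ Valid ((φ * ψ) * (ψ * φ))))

SomeWNonSymFails : BinOp → Set₁
SomeWNonSymFails _*_ = Σ Form (λ φ → Σ Form (λ ψ → ¬ ((φ * ψ) ⊨₁ (ψ * φ))))

PlainlyConnexive : BinOp → Set₁
PlainlyConnexive * = AT * × BT * × SomeNonSymFails *

WeaklyConnexive : BinOp → Set₁
WeaklyConnexive * = AT * × WBT * × SomeWNonSymFails *

WeaklyPartiallyConnexive : BinOp → Set₁
WeaklyPartiallyConnexive * = WBT * × SomeWNonSymFails *

WeaklyPartiallyHyperconnexive : BinOp → Set₁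
WeaklyPartiallyHyperconnexive * = WeaklyPartiallyConnexive * × WCBT *

{-# OPTIONS --safe #-}
module Submission where

open import Defs
open import Data.Product using (_×_; _,_; proj₁; proj₂)
open import Data.Product.Function.NonDependent.Propositional using (_×-⇔_)
open import Data.Sum using (inj₁; inj₂)
open import Data.Sum.Function.Propositional using (_⊎-⇔_)
open import Data.Unit using (⊤; tt)
open import Data.List.Relation.Unary.All using ([]; _∷_)
open import Function using (_∘_)
open import Function.Bundles using (_⇔_; mk⇔; Equivalence)
open import Relation.Binary.PropositionalEquality using (_≡_; refl)
open import Relation.Nullary using (¬_)

open Equivalence using (to; from)

-- Both □→ and ◇→ pass the polarity of the whole formula on to the consequent, so
-- φ ∗ ∼ψ and ∼(φ ∗ ψ) have literally the same support, which gives WBT and WCBT;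
-- □⇒ and ◇⇒ inherit WBT from their first conjunct.  Everything else is refuted on
-- a single reflexive world on which letter 0 is true and letter 1 false: there
-- φ □→ ψ and φ ◇→ ψ collapse to ψ, and φ □⇒ ψ and φ ◇⇒ ψ to ψ ∧ ∼φ.

⊨₁-intro : ∀ {φ ψ} → (∀ M w → sat M pos w φ → sat M pos w ψ) → φ ⊨₁ ψ
⊨₁-intro φ→ψ M w (φ⁺ ∷ [] , ¬ψ⁺ ∷ []) = ¬ψ⁺ (φ→ψ M w φ⁺)

countermodel-⊨₁ : ∀ {φ ψ} M w → sat M pos w φ → ¬ sat M pos w ψ → ¬ φ ⊨₁ ψ
countermodel-⊨₁ M w φ⁺ ¬ψ⁺ φ⊨ψ = φ⊨ψ M w (φ⁺ ∷ [] , ¬ψ⁺ ∷ [])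

countermodel-Valid : ∀ {φ} M w → ¬ sat M pos w φ → ¬ Valid φ
countermodel-Valid M w ¬φ⁺ valid = valid M w ([] , ¬φ⁺ ∷ [])

WBT-pointwise : BinOp → Set₁
WBT-pointwise _*_ = ∀ M w φ ψ → sat M pos w (φ * (∼ ψ)) → sat M neg w (φ * ψ)

WCBT-pointwise : BinOp → Set₁
WCBT-pointwise _*_ = ∀ M w φ ψ → sat M neg w (φ * ψ) → sat M pos w (φ * (∼ ψ))

WBT-pointwise⇒WBT : ∀ {_*_} → WBT-pointwise _*_ → WBT _*_
WBT-pointwise⇒WBT wbt φ ψ = ⊨₁-intro λ M w → wbt M w φ ψ

WCBT-pointwise⇒WCBT : ∀ {_*_} → WCBT-pointwise _*_ → WCBT _*_
WCBT-pointwise⇒WCBT wcbt φ ψ = ⊨₁-intro λ M w → wcbt M w φ ψ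

¬AT⇒¬WeaklyConnexive : ∀ {_*_} → ¬ AT _*_ → ¬ WeaklyConnexive _*_
¬AT⇒¬WeaklyConnexive ¬at = ¬at ∘ proj₁

¬AT⇒¬PlainlyConnexive : ∀ {_*_} → ¬ AT _*_ → ¬ PlainlyConnexive _*_
¬AT⇒¬PlainlyConnexive ¬at = ¬at ∘ proj₁

¬WCBT⇒¬WeaklyPartiallyHyperconnexive : ∀ {_*_} → ¬ WCBT _*_ → ¬ WeaklyPartiallyHyperconnexive _*_
¬WCBT⇒¬WeaklyPartiallyHyperconnexive ¬wcbt = ¬wcbt ∘ proj₂

-- _□⇒_ and _◇⇒_ are definitionally Contraposed _□→_ and Contraposed _◇→_.
Contraposed : BinOp → BinOp
Contraposed _*_ φ ψ = (φ * ψ) ∧ ((∼ ψ) * (∼ φ))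

WBT-pointwise-Contraposed : ∀ {_*_} → WBT-pointwise _*_ → WBT-pointwise (Contraposed _*_)
WBT-pointwise-Contraposed wbt M w φ ψ = inj₁ ∘ wbt M w φ ψ ∘ proj₁

□→-WBT-pointwise : WBT-pointwise _□→_
□→-WBT-pointwise M w φ ψ φ□→∼ψ = φ□→∼ψ

□→-WCBT-pointwise : WCBT-pointwise _□→_
□→-WCBT-pointwise M w φ ψ φ□→ψ⁻ = φ□→ψ⁻

◇→-WBT-pointwise : WBT-pointwise _◇→_
◇→-WBT-pointwise M w φ ψ φ◇→∼ψ = φ◇→∼ψ

◇→-WCBT-pointwise : WCBT-pointwise _◇→_
◇→-WCBT-pointwise M w φ ψ φ◇→ψ⁻ = φ◇→ψ⁻

point : Model
point = record
  { W = ⊤ ; w₀ = tt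
  ; _≤_ = λ _ _ → ⊤ ; ≤-refl = tt ; ≤-trans = λ _ _ → tt
  ; R = λ _ _ _ _ → ⊤ ; R-ext = λ _ _ _ → tt
  ; V⁺ = λ p _ → p ≡ 0 ; V⁻ = λ p _ → p ≡ 1
  ; V⁺-up = λ _ _ v → v ; V⁻-up = λ _ _ v → v
  ; c1 = λ _ _ _ _ → tt , tt , tt ; c2 = λ _ _ _ _ → tt , tt , tt
  }

t f : Form
t = var 0
f = var 1

ReducesAtPoint : BinOp → BinOp → Set
ReducesAtPoint _*_ _◦_ = ∀ s φ ψ → sat point s tt (φ * ψ) ⇔ sat point s tt (φ ◦ ψ)

consequent : BinOp
consequent _ ψ = ψ

□→-reduces-at-point : ReducesAtPoint _□→_ consequent
□→-reduces-at-point pos φ ψ = mk⇔ (λ φ□→ψ → φ□→ψ tt tt tt tt) (λ ψ⁺ _ _ _ _ → ψ⁺)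
□→-reduces-at-point neg φ ψ = mk⇔ (λ φ□→ψ → φ□→ψ tt tt tt tt) (λ ψ⁻ _ _ _ _ → ψ⁻)

◇→-reduces-at-point : ReducesAtPoint _◇→_ consequent
◇→-reduces-at-point pos φ ψ = mk⇔ (λ (_ , _ , ψ⁺) → ψ⁺) (λ ψ⁺ → tt , tt , ψ⁺)
◇→-reduces-at-point neg φ ψ = mk⇔ (λ (_ , _ , ψ⁻) → ψ⁻) (λ ψ⁻ → tt , tt , ψ⁻)

ReducesAtPoint-Contraposed : ∀ {_*_} → ReducesAtPoint _*_ consequent →
                          ReducesAtPoint (Contraposed _*_) (λ φ ψ → ψ ∧ ∼ φ)
ReducesAtPoint-Contraposed r pos φ ψ = r pos φ ψ ×-⇔ r pos (∼ ψ) (∼ φ)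
ReducesAtPoint-Contraposed r neg φ ψ = r neg φ ψ ⊎-⇔ r neg (∼ ψ) (∼ φ)

module _ {_*_ _◦_ : BinOp} (reduct : ReducesAtPoint _*_ _◦_) where

  ¬AT-at-point : ¬ sat point neg tt ((∼ t) ◦ t) → ¬ AT _*_
  ¬AT-at-point ¬∼t◦t⁻ at =
    countermodel-Valid point tt (¬∼t◦t⁻ ∘ to (reduct neg (∼ t) t)) (at t)

  WNonSym-fails-at-point : sat point pos tt (f ◦ t) → ¬ sat point pos tt (t ◦ f) →
                           SomeWNonSymFails _*_
  WNonSym-fails-at-point f◦t⁺ ¬t◦f⁺ =
    f , t , countermodel-⊨₁ point tt (from (reduct pos f t) f◦t⁺) (¬t◦f⁺ ∘ to (reduct pos t f))

  ¬WCBT-at-point : sat point neg tt (t ◦ t) → ¬ sat point pos tt (t ◦ (∼ t)) → ¬ WCBT _*_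
  ¬WCBT-at-point t◦t⁻ ¬t◦∼t⁺ wcbt =
    countermodel-⊨₁ point tt (from (reduct neg t t) t◦t⁻) (¬t◦∼t⁺ ∘ to (reduct pos t (∼ t)))
                    (wcbt t t)

hyperconnexive-not-connexive :
  ∀ {_*_} → WBT-pointwise _*_ → WCBT-pointwise _*_ → ReducesAtPoint _*_ consequent →
  WeaklyPartiallyHyperconnexive _*_ × ¬ WeaklyConnexive _*_ × ¬ PlainlyConnexive _*_
hyperconnexive-not-connexive {_*_} wbt wcbt reduct =
  ((WBT-pointwise⇒WBT wbt , WNonSym-fails-at-point reduct refl λ ()) , WCBT-pointwise⇒WCBT wcbt) ,
  ¬AT⇒¬WeaklyConnexive {_*_} ¬at , ¬AT⇒¬PlainlyConnexive {_*_} ¬at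
  where
  ¬at : ¬ AT _*_
  ¬at = ¬AT-at-point reduct λ ()

Contraposed-partially-connexive :
  ∀ {_*_} → WBT-pointwise _*_ → ReducesAtPoint _*_ consequent →
  let _⋆_ = Contraposed _*_ in
  WeaklyPartiallyConnexive _⋆_ × ¬ WeaklyConnexive _⋆_ × ¬ PlainlyConnexive _⋆_
    × ¬ WeaklyPartiallyHyperconnexive _⋆_
Contraposed-partially-connexive {_*_} wbt reduct =
  (WBT-pointwise⇒WBT (WBT-pointwise-Contraposed {_*_} wbt) ,
   WNonSym-fails-at-point reduct′ (refl , refl) λ ()) ,
  ¬AT⇒¬WeaklyConnexive {_⋆_} ¬at , ¬AT⇒¬PlainlyConnexive {_⋆_} ¬at ,
  ¬WCBT⇒¬WeaklyPartiallyHyperconnexive {_⋆_} (¬WCBT-at-point reduct′ (inj₂ refl) λ ())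
  where
  _⋆_ : BinOp
  _⋆_ = Contraposed _*_
  reduct′ : ReducesAtPoint _⋆_ (λ φ ψ → ψ ∧ ∼ φ)
  reduct′ = ReducesAtPoint-Contraposed reduct
  ¬at : ¬ AT _⋆_
  ¬at = ¬AT-at-point reduct′ λ { (inj₁ ()) ; (inj₂ ()) }

proposition5p22 :
    (WeaklyPartiallyHyperconnexive _□→_ × ¬ WeaklyConnexive _□→_ × ¬ PlainlyConnexive _□→_)
    × (WeaklyPartiallyHyperconnexive _◇→_ × ¬ WeaklyConnexive _◇→_ × ¬ PlainlyConnexive _◇→_)
    × (WeaklyPartiallyConnexive _□⇒_ × ¬ WeaklyConnexive _□⇒_ × ¬ PlainlyConnexive _□⇒_
        × ¬ WeaklyPartiallyHyperconnexive _□⇒_)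
    × (WeaklyPartiallyConnexive _◇⇒_ × ¬ WeaklyConnexive _◇⇒_ × ¬ PlainlyConnexive _◇⇒_
        × ¬ WeaklyPartiallyHyperconnexive _◇⇒_)
proposition5p22 =
  hyperconnexive-not-connexive □→-WBT-pointwise □→-WCBT-pointwise □→-reduces-at-point ,
  hyperconnexive-not-connexive ◇→-WBT-pointwise ◇→-WCBT-pointwise ◇→-reduces-at-point ,
  Contraposed-partially-connexive □→-WBT-pointwise □→-reduces-at-point ,
  Contraposed-partially-connexive ◇→-WBT-pointwise ◇→-reduces-at-point
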